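{- Let $a,c$ be positive integers. A quarter complementary plane partition inside a $(2a,2a,2c)$-box is quasi transpose-complementary if and only if it is quasi symmetric and self-complementary. The number of quasi transpose-complementary quarter complementary plane partitions inside a $(2a,2a,2c)$-box is $2^a$.
   Context: A quarter complementary plane partition (QCPP) inside a $(2a,2a,2c)$-box is a plane partition $\pi=(\pi_{i,j})_{i,j\ge1}$ (non-negative integers, finitely many nonzero, weakly decreasing along rows and columns) with $\pi_{i,j}=0$ unless $i,j\le 2a$, such that for all $1\le i,j\le 2a$: $\pi_{i,j}\pi_{2a+1-i,2a+1-j}=0$ and $\pi_{i,j}+\pi_{2a+1-i,j}+\pi_{i,2a+1-j}+\pi_{2a+1-i,2a+1-j}=2c$. It is quasi symmetric if $\pi_{i,j}=\pi_{j,i}$ for all $1\le i,j\le 2a$ with $i\ne 2a+1-j$; self-complementary if $\pi_{i,j}+\pi_{2a+1-i,2a+1-j}=c$ for all $1\le i,j\le 2a$; quasi transpose-complementary if $\pi_{i,j}+\pi_{2a+1-j,2a+1-i}=c$ for all $1\le i,j\le 2a$ with $i\ne 2a+1-j$. -}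

module Defs where

open import Data.Nat using (ℕ; _+_; _*_; _≥_)
open import Data.Fin as Fin using (Fin; opposite)
open import Data.Vec using (Vec; lookup)
open import Data.Product using (_×_)
open import Relation.Binary.PropositionalEquality using (_≡_)
open import Relation.Nullary using (¬_)

-- A plane partition whose support lies in the (2a × 2a) square is recorded
-- by its 2a × 2a block of entries (entries outside are 0 by definition).
-- Row i (0-indexed), column j.
Matrix : ℕ → Set
Matrix a = Vec (Vec ℕ (2 * a)) (2 * a)

entry : ∀ {n} → Vec (Vec ℕ n) n → Fin n → Fin n → ℕ
entry π i j = lookup (lookup π i) j

-- 0-indexed i ↦ 2a-1-i corresponds to 1-indexed i ↦ 2a+1-i.
rev : ∀ {n} → Fin n → Fin n
rev = opposite

IsPlanePartition : (a : ℕ) → Matrix a → Set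
IsPlanePartition a π =
  (∀ (i i' j : Fin (2 * a)) → i Fin.≤ i' → entry π i j ≥ entry π i' j) ×
  (∀ (i j j' : Fin (2 * a)) → j Fin.≤ j' → entry π i j ≥ entry π i j')

IsQCPP : (a c : ℕ) → Matrix a → Set
IsQCPP a c π =
  IsPlanePartition a π ×
  (∀ i j → entry π i j * entry π (rev i) (rev j) ≡ 0) ×
  (∀ i j → entry π i j + entry π (rev i) j + entry π i (rev j)
             + entry π (rev i) (rev j) ≡ 2 * c)

IsQuasiSymmetric : (a : ℕ) → Matrix a → Set
IsQuasiSymmetric a π =
  ∀ (i j : Fin (2 * a)) → ¬ (i ≡ rev j) → entry π i j ≡ entry π j i

IsSelfComplementary : (a : ℕ) → ℕ → Matrix a → Set
IsSelfComplementary a c π =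
  ∀ (i j : Fin (2 * a)) → entry π i j + entry π (rev i) (rev j) ≡ c

IsQuasiTransposeComplementary : (a : ℕ) → ℕ → Matrix a → Set
IsQuasiTransposeComplementary a c π =
  ∀ (i j : Fin (2 * a)) → ¬ (i ≡ rev j) → entry π i j + entry π (rev j) (rev i) ≡ c

-- Write p i j for the (0-indexed) entries and m = 2a − 1, so that rev is i ↦ m − i.
-- Away from the antidiagonal, the transpose-complementary relations at (i, j) and (j, i),
-- together with the vanishing products p i j · p (m−i) (m−j) = 0, force p i j = p j i and
-- p i j + p (m−i) (m−j) = c; the four-corner sum then gives self-complementarity on the
-- antidiagonal too. Hence every entry is 0 or c, and monotonicity makes π equal to c strictly
-- above the antidiagonal and 0 strictly below. On the antidiagonal the entries of rows
-- 0, …, a−1 can be chosen freely and determine the others: a bijection with {0,1}ᵃ.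
module Submission where

open import Data.Bool using (Bool; true; false; not)
open import Data.Empty using (⊥-elim)
open import Data.Fin as Fin using (Fin; toℕ; fromℕ<; inject≤)
open import Data.Fin.Properties
  using (toℕ<n; toℕ-injective; toℕ-fromℕ<; toℕ-inject≤; opposite-prop; opposite-involutive)
open import Data.List using (List; []; _∷_; map; _++_; length)
open import Data.List.Membership.Propositional using (_∈_)
open import Data.List.Membership.Propositional.Properties using (∈-map⁺; ∈-map⁻; ∈-++⁺ˡ; ∈-++⁺ʳ)
open import Data.List.Properties using (length-++; length-map)
open import Data.List.Relation.Unary.All using ([])
open import Data.List.Relation.Unary.AllPairs using ([]; _∷_)
open import Data.List.Relation.Unary.Any using (here)
open import Data.List.Relation.Unary.Unique.Propositional using (Unique)
import Data.List.Relation.Unary.Unique.Propositional.Properties as Unique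
open import Data.Nat
open import Data.Nat.Properties
open import Data.Product using (_×_; _,_; proj₁; proj₂; ∃-syntax)
open import Data.Sum using (_⊎_; inj₁; inj₂)
open import Data.Vec using (Vec; []; _∷_; lookup; tabulate)
open import Data.Vec.Properties using (lookup∘tabulate; tabulate∘lookup; tabulate-cong; ∷-injectiveʳ)
open import Function using (_∘_)
open import Function.Bundles using (_⇔_; mk⇔)
open import Relation.Binary using (Tri; tri<; tri≈; tri>)
open import Relation.Binary.PropositionalEquality
open import Relation.Nullary using (¬_; Dec; yes; no)
open import Algebra.Properties.CommutativeSemigroup +-commutativeSemigroup using (interchange)

open import Defs

x+x≢1+y+y : ∀ x y → x + x ≢ suc (y + y)
x+x≢1+y+y zero    y       ()
x+x≢1+y+y (suc x) zero    eq = 0≢1+n (sym (trans (sym (+-suc x x)) (suc-injective eq)))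
x+x≢1+y+y (suc x) (suc y) eq rewrite +-suc x x | +-suc y y =
  x+x≢1+y+y x y (suc-injective (suc-injective eq))

cross-complements : ∀ {c x y u v} → x + v ≡ suc c → y + u ≡ suc c → x * u ≡ 0 → y * v ≡ 0 →
                    x ≡ y × x + u ≡ suc c
cross-complements {x = x} {y} x+v y+u xu yv with m*n≡0⇒m≡0∨n≡0 x xu | m*n≡0⇒m≡0∨n≡0 y yv
... | inj₁ refl | inj₁ refl = refl , y+u
... | inj₁ refl | inj₂ refl = ⊥-elim (0≢1+n x+v)
... | inj₂ refl | inj₁ refl = ⊥-elim (0≢1+n y+u)
... | inj₂ refl | inj₂ refl = +-cancelʳ-≡ 0 x y (trans x+v (sym y+u)) , x+v

*≡0⇒≡0⊎≡ : ∀ {x y s} → x + y ≡ s → x * y ≡ 0 → x ≡ 0 ⊎ x ≡ s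
*≡0⇒≡0⊎≡ {x} x+y xy with m*n≡0⇒m≡0∨n≡0 x xy
... | inj₁ x≡0 = inj₁ x≡0
... | inj₂ refl = inj₂ (trans (sym (+-identityʳ x)) x+y)

≡0⊎≡⇒*≡0 : ∀ {x y s} → x + y ≡ s → x ≡ 0 ⊎ x ≡ s → x * y ≡ 0
≡0⊎≡⇒*≡0 _ (inj₁ refl) = refl
≡0⊎≡⇒*≡0 {x} {y} x+y (inj₂ refl) =
  trans (cong (x *_) (+-cancelˡ-≡ x y 0 (trans x+y (sym (+-identityʳ x))))) (*-zeroʳ x)

w+x+y+z≡[w+z]+[y+x] : ∀ w x y z → w + x + y + z ≡ (w + z) + (y + x)
w+x+y+z≡[w+z]+[y+x] w x y z = begin
  w + x + y + z     ≡⟨ +-assoc (w + x) y z ⟩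
  w + x + (y + z)   ≡⟨ cong (w + x +_) (+-comm y z) ⟩
  w + x + (z + y)   ≡⟨ interchange w x z y ⟩
  (w + z) + (x + y) ≡⟨ cong (w + z +_) (+-comm x y) ⟩
  (w + z) + (y + x) ∎
  where open ≡-Reasoning

module _ {m x y : ℕ} (x≤m : x ≤ m) (y≤m : y ≤ m) where

  mirror-sum : (x + y) + ((m ∸ x) + (m ∸ y)) ≡ m + m
  mirror-sum = trans (interchange x y (m ∸ x) (m ∸ y)) (cong₂ _+_ (m+[n∸m]≡n x≤m) (m+[n∸m]≡n y≤m))

  <⇒mirror> : x + y < m → m < (m ∸ x) + (m ∸ y)
  <⇒mirror> lt = ≰⇒> (λ ≤m → <-irrefl mirror-sum (+-mono-<-≤ lt ≤m))

  >⇒mirror< : m < x + y → (m ∸ x) + (m ∸ y) < m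
  >⇒mirror< gt = ≰⇒> (λ m≤ → <-irrefl (sym mirror-sum) (+-mono-<-≤ gt m≤))

bitAt : ∀ {k} → Vec Bool k → ℕ → Bool
bitAt []      _       = false
bitAt (b ∷ _) zero    = b
bitAt (_ ∷ v) (suc x) = bitAt v x

bitAt-toℕ : ∀ {k} (v : Vec Bool k) (i : Fin k) → bitAt v (toℕ i) ≡ lookup v i
bitAt-toℕ (b ∷ _) Fin.zero    = refl
bitAt-toℕ (_ ∷ v) (Fin.suc i) = bitAt-toℕ v i

tabulate² : ∀ {n} → (Fin n → Fin n → ℕ) → Vec (Vec ℕ n) n
tabulate² f = tabulate λ i → tabulate (f i)

entry∘tabulate² : ∀ {n} (f : Fin n → Fin n → ℕ) i j → entry (tabulate² f) i j ≡ f i j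
entry∘tabulate² f i j =
  trans (cong (λ row → lookup row j) (lookup∘tabulate _ i)) (lookup∘tabulate (f i) j)

tabulate²-≗entry : ∀ {n} {f : Fin n → Fin n → ℕ} (π : Vec (Vec ℕ n) n) →
                  (∀ i j → f i j ≡ entry π i j) → tabulate² f ≡ π
tabulate²-≗entry π f≗π = trans
  (tabulate-cong λ i → trans (tabulate-cong (f≗π i)) (tabulate∘lookup (lookup π i)))
  (tabulate∘lookup π)

bitVectors : ∀ k → List (Vec Bool k)
bitVectors zero    = [] ∷ []
bitVectors (suc k) = map (true ∷_) (bitVectors k) ++ map (false ∷_) (bitVectors k)

length-bitVectors : ∀ k → length (bitVectors k) ≡ 2 ^ k
length-bitVectors zero    = refl
length-bitVectors (suc k) = begin
  length (map (true ∷_) bs ++ map (false ∷_) bs)       ≡⟨ length-++ (map (true ∷_) bs) ⟩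
  length (map (true ∷_) bs) + length (map (false ∷_) bs) ≡⟨ cong₂ _+_ (length-map _ bs) (length-map _ bs) ⟩
  length bs + length bs                                 ≡⟨ cong₂ _+_ (length-bitVectors k) (length-bitVectors k) ⟩
  2 ^ k + 2 ^ k                                         ≡⟨ cong (2 ^ k +_) (sym (+-identityʳ (2 ^ k))) ⟩
  2 ^ suc k                                             ∎
  where
  open ≡-Reasoning
  bs : List (Vec Bool k)
  bs = bitVectors k

bitVectors-unique : ∀ k → Unique (bitVectors k)
bitVectors-unique zero    = [] ∷ []
bitVectors-unique (suc k) = Unique.++⁺ (Unique.map⁺ ∷-injectiveʳ (bitVectors-unique k))
                                       (Unique.map⁺ ∷-injectiveʳ (bitVectors-unique k))
                                       heads-differ
  where
  heads-differ : ∀ {w} → ¬ (w ∈ map (true ∷_) (bitVectors k) × w ∈ map (false ∷_) (bitVectors k))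
  heads-differ (∈true , ∈false) with ∈-map⁻ (true ∷_) ∈true | ∈-map⁻ (false ∷_) ∈false
  ... | _ , _ , refl | _ , _ , ()

∈-bitVectors : ∀ {k} (v : Vec Bool k) → v ∈ bitVectors k
∈-bitVectors []          = here refl
∈-bitVectors (true ∷ v)  = ∈-++⁺ˡ (∈-map⁺ (true ∷_) (∈-bitVectors v))
∈-bitVectors (false ∷ v) = ∈-++⁺ʳ (map (true ∷_) (bitVectors _)) (∈-map⁺ (false ∷_) (∈-bitVectors v))

module QuarterComplementary (a′ k : ℕ) where

  a n m c : ℕ
  a = suc a′
  n = 2 * a
  m = n ∸ 1
  c = suc k

  Index : Set
  Index = Fin n

  m≡1+a′+a′ : m ≡ suc (a′ + a′)
  m≡1+a′+a′ = trans (cong (a′ +_) (cong suc (+-identityʳ a′))) (+-suc a′ a′)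

  toℕ≤m : ∀ (i : Index) → toℕ i ≤ m
  toℕ≤m i = s≤s⁻¹ (toℕ<n i)

  toℕ-rev : ∀ (i : Index) → toℕ (rev i) ≡ m ∸ toℕ i
  toℕ-rev = opposite-prop

  rev-involutive : ∀ (i : Index) → rev (rev i) ≡ i
  rev-involutive = opposite-involutive

  ≡rev⇒+≡m : ∀ {i j : Index} → i ≡ rev j → toℕ i + toℕ j ≡ m
  ≡rev⇒+≡m {j = j} refl = trans (cong (_+ toℕ j) (toℕ-rev j)) (m∸n+n≡m (toℕ≤m j))

  +≡m⇒≡rev : ∀ {i j : Index} → toℕ i + toℕ j ≡ m → i ≡ rev j
  +≡m⇒≡rev {i} {j} e = toℕ-injective (trans (sym (m+n∸n≡m (toℕ i) (toℕ j)))
                                            (trans (cong (_∸ toℕ j) e) (sym (toℕ-rev j))))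

  rev-irreflexive : ∀ (i : Index) → i ≢ rev i
  rev-irreflexive i i≡rev-i =
    x+x≢1+y+y (toℕ i) a′ (trans (≡rev⇒+≡m i≡rev-i) m≡1+a′+a′)

  ≢rev-sym : ∀ {i j : Index} → i ≢ rev j → j ≢ rev i
  ≢rev-sym {i} i≢rev-j j≡rev-i = i≢rev-j (trans (sym (rev-involutive i)) (cong rev (sym j≡rev-i)))

  +≡m-halves : ∀ {x y} → x + y ≡ m → x < a → ¬ y < a
  +≡m-halves {x} {y} e x<a y<a =
    <-irrefl e (subst (x + y <_) (sym m≡1+a′+a′) (s≤s (+-mono-≤ (s≤s⁻¹ x<a) (s≤s⁻¹ y<a))))

  +≡m-lower-half : ∀ {x y} → x + y ≡ m → ¬ x < a → y < a
  +≡m-lower-half {x} {y} e x≮a = ≰⇒> λ a≤y →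
    <-irrefl refl (subst (_≤ x + y) a+a≡1+x+y (+-mono-≤ (≮⇒≥ x≮a) a≤y))
    where
    a+a≡1+x+y : a + a ≡ suc (x + y)
    a+a≡1+x+y = cong suc (trans (cong (a′ +_) (cong suc (sym (+-identityʳ a′)))) (sym e))

  sc⇒corner-sum : ∀ {π : Matrix a} → IsSelfComplementary a c π → ∀ i j →
    entry π i j + entry π (rev i) j + entry π i (rev j) + entry π (rev i) (rev j) ≡ 2 * c
  sc⇒corner-sum {π} sc i j =
    trans (w+x+y+z≡[w+z]+[y+x] (p i j) (p (rev i) j) (p i (rev j)) (p (rev i) (rev j)))
          (trans (cong₂ _+_ (sc i j) other-corners) (cong (c +_) (sym (+-identityʳ c))))
    where
    p : Index → Index → ℕ
    p = entry π
    other-corners : p i (rev j) + p (rev i) j ≡ c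
    other-corners = subst (λ l → p i (rev j) + p (rev i) l ≡ c) (rev-involutive j) (sc i (rev j))

  qs×sc⇒qtc : ∀ {π : Matrix a} → IsQuasiSymmetric a π → IsSelfComplementary a c π →
              IsQuasiTransposeComplementary a c π
  qs×sc⇒qtc {π} qs sc i j i≢rev-j =
    trans (cong (entry π i j +_) (qs (rev j) (rev i) rev-j≢rev²i)) (sc i j)
    where
    rev-j≢rev²i : rev j ≢ rev (rev i)
    rev-j≢rev²i eq = i≢rev-j (sym (trans eq (rev-involutive i)))

  module _ {π : Matrix a} (qcpp : IsQCPP a c π) (qtc : IsQuasiTransposeComplementary a c π) where

    private
      p : Index → Index → ℕ
      p = entry π

      vanishing : ∀ i j → p i j * p (rev i) (rev j) ≡ 0
      vanishing = proj₁ (proj₂ qcpp)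

      four-corners : ∀ i j → p i j + p (rev i) j + p i (rev j) + p (rev i) (rev j) ≡ 2 * c
      four-corners = proj₂ (proj₂ qcpp)

      off-antidiagonal : ∀ i j → i ≢ rev j → p i j ≡ p j i × p i j + p (rev i) (rev j) ≡ c
      off-antidiagonal i j i≢rev-j = cross-complements
        (qtc i j i≢rev-j) (qtc j i (≢rev-sym i≢rev-j)) (vanishing i j) (vanishing j i)

    qtc⇒qs : IsQuasiSymmetric a π
    qtc⇒qs i j i≢rev-j = proj₁ (off-antidiagonal i j i≢rev-j)

    -- On the antidiagonal the two other corners (i, i) and (m−i, m−i) lie off it.
    qtc⇒sc : IsSelfComplementary a c π
    qtc⇒sc i j with i Fin.≟ rev j
    ... | no i≢rev-j = proj₂ (off-antidiagonal i j i≢rev-j)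
    ... | yes i≡rev-j = +-cancelʳ-≡ c _ _ (begin
      p i j + p (rev i) (rev j) + c
        ≡⟨ cong (p i j + p (rev i) (rev j) +_) (sym other-corners) ⟩
      p i j + p (rev i) (rev j) + (p i (rev j) + p (rev i) j)
        ≡⟨ sym (w+x+y+z≡[w+z]+[y+x] (p i j) (p (rev i) j) (p i (rev j)) (p (rev i) (rev j))) ⟩
      p i j + p (rev i) j + p i (rev j) + p (rev i) (rev j)
        ≡⟨ four-corners i j ⟩
      c + (c + 0)
        ≡⟨ cong (c +_) (+-identityʳ c) ⟩
      c + c
        ∎)
      where
      open ≡-Reasoning
      i≢rev²j : i ≢ rev (rev j)
      i≢rev²j i≡rev²j = rev-irreflexive i (sym (trans (cong rev i≡rev-j) (sym i≡rev²j)))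
      other-corners : p i (rev j) + p (rev i) j ≡ c
      other-corners = subst (λ l → p i (rev j) + p (rev i) l ≡ c) (rev-involutive j)
                            (proj₂ (off-antidiagonal i (rev j) i≢rev²j))

  qtc⇔qs×sc : ∀ (π : Matrix a) → IsQCPP a c π →
    IsQuasiTransposeComplementary a c π ⇔ (IsQuasiSymmetric a π × IsSelfComplementary a c π)
  qtc⇔qs×sc π qcpp = mk⇔ (λ qtc → qtc⇒qs {π} qcpp qtc , qtc⇒sc {π} qcpp qtc)
                         (λ (qs , sc) → qs×sc⇒qtc {π} qs sc)

  height : Bool → ℕ
  height true  = c
  height false = 0

  positive-height : ∀ b → (0 <ᵇ height b) ≡ b
  positive-height true  = refl
  positive-height false = refl

  height-extreme : ∀ b → height b ≡ 0 ⊎ height b ≡ c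
  height-extreme true  = inj₂ refl
  height-extreme false = inj₁ refl

  height-not : ∀ b → height b + height (not b) ≡ c
  height-not true  = +-identityʳ c
  height-not false = refl

  height-positive : ∀ {e} → e ≡ 0 ⊎ e ≡ c → height (0 <ᵇ e) ≡ e
  height-positive (inj₁ refl) = refl
  height-positive (inj₂ refl) = refl

  height-not-positive : ∀ {x e} → x + e ≡ c → e ≡ 0 ⊎ e ≡ c → height (not (0 <ᵇ e)) ≡ x
  height-not-positive {x} x+e (inj₁ refl) = sym (trans (sym (+-identityʳ x)) x+e)
  height-not-positive {x} x+e (inj₂ refl) = sym (+-cancelʳ-≡ c x 0 x+e)

  Code : Set
  Code = Vec Bool a

  -- Cells are addressed by coordinates x, y ≤ m; the bit vector v fixes the antidiagonal
  -- entry (x, m − x) for x < a, and transpose-complementarity dictates it for x ≥ a.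
  antidiagonal : Code → ℕ → ℕ → ℕ
  antidiagonal v x y with x <? a
  ... | yes _ = height (bitAt v x)
  ... | no  _ = height (not (bitAt v y))

  antidiagonal-upper : ∀ v x y → x < a → antidiagonal v x y ≡ height (bitAt v x)
  antidiagonal-upper v x _ x<a with x <? a
  ... | yes _   = refl
  ... | no  x≮a = ⊥-elim (x≮a x<a)

  antidiagonal-lower : ∀ v x y → ¬ x < a → antidiagonal v x y ≡ height (not (bitAt v y))
  antidiagonal-lower v x _ x≮a with x <? a
  ... | yes x<a = ⊥-elim (x≮a x<a)
  ... | no  _   = refl

  antidiagonal-complement : ∀ v x y → x + y ≡ m → antidiagonal v x y + antidiagonal v y x ≡ c
  antidiagonal-complement v x y e with x <? a
  ... | yes x<a rewrite antidiagonal-lower v y x (+≡m-halves e x<a) = height-not (bitAt v x)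
  ... | no  x≮a rewrite antidiagonal-upper v y x (+≡m-lower-half e x≮a) =
    trans (+-comm (height (not (bitAt v y))) _) (height-not (bitAt v y))

  antidiagonal-extreme : ∀ v x y → antidiagonal v x y ≡ 0 ⊎ antidiagonal v x y ≡ c
  antidiagonal-extreme v x y with x <? a
  ... | yes _ = height-extreme (bitAt v x)
  ... | no  _ = height-extreme (not (bitAt v y))

  stair : Code → ℕ → ℕ → ℕ
  stair v x y with <-cmp (x + y) m
  ... | tri< _ _ _ = c
  ... | tri≈ _ _ _ = antidiagonal v x y
  ... | tri> _ _ _ = 0

  stair-< : ∀ v x y → x + y < m → stair v x y ≡ c
  stair-< v x y lt with <-cmp (x + y) m
  ... | tri< _ _ _    = refl
  ... | tri≈ ≮ _ _    = ⊥-elim (≮ lt)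
  ... | tri> ≮ _ _    = ⊥-elim (≮ lt)

  stair-≡ : ∀ v x y → x + y ≡ m → stair v x y ≡ antidiagonal v x y
  stair-≡ v x y e with <-cmp (x + y) m
  ... | tri< _ ≢ _    = ⊥-elim (≢ e)
  ... | tri≈ _ _ _    = refl
  ... | tri> _ ≢ _    = ⊥-elim (≢ e)

  stair-> : ∀ v x y → m < x + y → stair v x y ≡ 0
  stair-> v x y gt with <-cmp (x + y) m
  ... | tri< _ _ ≯    = ⊥-elim (≯ gt)
  ... | tri≈ _ _ ≯    = ⊥-elim (≯ gt)
  ... | tri> _ _ _    = refl

  stair-extreme : ∀ v x y → stair v x y ≡ 0 ⊎ stair v x y ≡ c
  stair-extreme v x y with <-cmp (x + y) m
  ... | tri< _ _ _    = inj₂ refl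
  ... | tri≈ _ _ _    = antidiagonal-extreme v x y
  ... | tri> _ _ _    = inj₁ refl

  stair-complement : ∀ v {x y} → x ≤ m → y ≤ m → stair v x y + stair v (m ∸ x) (m ∸ y) ≡ c
  stair-complement v {x} {y} x≤m y≤m = by-position (<-cmp (x + y) m)
    where
    open ≡-Reasoning
    mirror : ∀ s t → s + t ≡ m → m ∸ s ≡ t
    mirror s t s+t = trans (cong (_∸ s) (sym s+t)) (m+n∸m≡n s t)
    by-position : Tri (x + y < m) (x + y ≡ m) (m < x + y) → stair v x y + stair v (m ∸ x) (m ∸ y) ≡ c
    by-position (tri< lt _ _) = trans
      (cong₂ _+_ (stair-< v x y lt) (stair-> v (m ∸ x) (m ∸ y) (<⇒mirror> x≤m y≤m lt)))
      (+-identityʳ c)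
    by-position (tri> _ _ gt) =
      cong₂ _+_ (stair-> v x y gt) (stair-< v (m ∸ x) (m ∸ y) (>⇒mirror< x≤m y≤m gt))
    by-position (tri≈ _ e _) = begin
      stair v x y + stair v (m ∸ x) (m ∸ y)   ≡⟨ cong₂ (λ s t → stair v x y + stair v s t) (mirror x y e) (mirror y x e′) ⟩
      stair v x y + stair v y x               ≡⟨ cong₂ _+_ (stair-≡ v x y e) (stair-≡ v y x e′) ⟩
      antidiagonal v x y + antidiagonal v y x ≡⟨ antidiagonal-complement v x y e ⟩
      c                                       ∎
      where
      e′ : y + x ≡ m
      e′ = trans (+-comm y x) e

  stair-symmetric : ∀ v x y → x + y ≢ m → stair v x y ≡ stair v y x
  stair-symmetric v x y x+y≢m with <-cmp (x + y) m
  ... | tri< lt _ _ = sym (stair-< v y x (subst (_< m) (+-comm x y) lt))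
  ... | tri≈ _ e _  = ⊥-elim (x+y≢m e)
  ... | tri> _ _ gt = sym (stair-> v y x (subst (m <_) (+-comm x y) gt))

  -- If neither x + y < m nor m < x′ + y′, then x + y = m = x′ + y′, which forces x = x′ and y = y′.
  stair-antitone : ∀ v {x y x′ y′} → x ≤ x′ → y ≤ y′ → stair v x′ y′ ≤ stair v x y
  stair-antitone v {x} {y} {x′} {y′} x≤x′ y≤y′ with x + y <? m | m <? x′ + y′
  ... | yes lt | _ = subst (stair v x′ y′ ≤_) (sym (stair-< v x y lt)) (≤c (stair-extreme v x′ y′))
    where
    ≤c : ∀ {e} → e ≡ 0 ⊎ e ≡ c → e ≤ c
    ≤c (inj₁ refl) = z≤n
    ≤c (inj₂ refl) = ≤-refl
  ... | no _ | yes gt = subst (_≤ stair v x y) (sym (stair-> v x′ y′ gt)) z≤n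
  ... | no x+y≮m | no x′+y′≯m = ≤-reflexive (cong₂ (stair v) (sym x≡x′) (sym y≡y′))
    where
    +≤+ : x + y ≤ x′ + y′
    +≤+ = +-mono-≤ x≤x′ y≤y′
    +≡+ : x + y ≡ x′ + y′
    +≡+ = ≤-antisym +≤+ (≤-trans (≮⇒≥ x′+y′≯m) (≮⇒≥ x+y≮m))
    x≡x′ : x ≡ x′
    x≡x′ = ≤-antisym x≤x′ (≮⇒≥ λ x<x′ → <-irrefl +≡+ (+-mono-<-≤ x<x′ y≤y′))
    y≡y′ : y ≡ y′
    y≡y′ = +-cancelˡ-≡ x y y′ (trans +≡+ (cong (_+ y′) (sym x≡x′)))

  staircase : Code → Matrix a
  staircase v = tabulate² λ i j → stair v (toℕ i) (toℕ j)

  entry-staircase : ∀ v i j → entry (staircase v) i j ≡ stair v (toℕ i) (toℕ j)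
  entry-staircase v = entry∘tabulate² _

  staircase-sc : ∀ v → IsSelfComplementary a c (staircase v)
  staircase-sc v i j
    rewrite entry-staircase v i j | entry-staircase v (rev i) (rev j) | toℕ-rev i | toℕ-rev j =
    stair-complement v (toℕ≤m i) (toℕ≤m j)

  staircase-qs : ∀ v → IsQuasiSymmetric a (staircase v)
  staircase-qs v i j i≢rev-j rewrite entry-staircase v i j | entry-staircase v j i =
    stair-symmetric v (toℕ i) (toℕ j) (i≢rev-j ∘ +≡m⇒≡rev)

  staircase-qcpp : ∀ v → IsQCPP a c (staircase v)
  staircase-qcpp v = (down-columns , along-rows) , vanishing , sc⇒corner-sum {staircase v} (staircase-sc v)
    where
    down-columns : ∀ (i i′ j : Index) → i Fin.≤ i′ → entry (staircase v) i j ≥ entry (staircase v) i′ j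
    down-columns i i′ j i≤i′ rewrite entry-staircase v i j | entry-staircase v i′ j =
      stair-antitone v i≤i′ (≤-refl {toℕ j})
    along-rows : ∀ (i j j′ : Index) → j Fin.≤ j′ → entry (staircase v) i j ≥ entry (staircase v) i j′
    along-rows i j j′ j≤j′ rewrite entry-staircase v i j | entry-staircase v i j′ =
      stair-antitone v (≤-refl {toℕ i}) j≤j′
    vanishing : ∀ i j → entry (staircase v) i j * entry (staircase v) (rev i) (rev j) ≡ 0
    vanishing i j = ≡0⊎≡⇒*≡0 {entry (staircase v) i j} {entry (staircase v) (rev i) (rev j)}
      (staircase-sc v i j)
      (subst (λ e → e ≡ 0 ⊎ e ≡ c) (sym (entry-staircase v i j)) (stair-extreme v (toℕ i) (toℕ j)))

  staircase-qtc : ∀ v → IsQuasiTransposeComplementary a c (staircase v)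
  staircase-qtc v = qs×sc⇒qtc {staircase v} (staircase-qs v) (staircase-sc v)

  upper : Fin a → Index
  upper i = inject≤ i (m≤m+n a (a + 0))

  upper-fromℕ< : ∀ (i : Index) (i<a : toℕ i < a) → upper (fromℕ< i<a) ≡ i
  upper-fromℕ< i i<a = toℕ-injective (trans (toℕ-inject≤ _ _) (toℕ-fromℕ< i<a))

  antidiagonal-bit : Matrix a → Index → Bool
  antidiagonal-bit π i = 0 <ᵇ entry π i (rev i)

  code : Matrix a → Code
  code π = tabulate (antidiagonal-bit π ∘ upper)

  bitAt-code : ∀ π (i : Index) → toℕ i < a → bitAt (code π) (toℕ i) ≡ antidiagonal-bit π i
  bitAt-code π i i<a = begin
    bitAt (code π) (toℕ i)                     ≡⟨ cong (bitAt (code π)) (sym (toℕ-fromℕ< i<a)) ⟩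
    bitAt (code π) (toℕ (fromℕ< i<a))          ≡⟨ bitAt-toℕ (code π) (fromℕ< i<a) ⟩
    lookup (code π) (fromℕ< i<a)               ≡⟨ lookup∘tabulate (antidiagonal-bit π ∘ upper) (fromℕ< i<a) ⟩
    antidiagonal-bit π (upper (fromℕ< i<a))    ≡⟨ cong (antidiagonal-bit π) (upper-fromℕ< i i<a) ⟩
    antidiagonal-bit π i                       ∎
    where open ≡-Reasoning

  code-staircase : ∀ v → code (staircase v) ≡ v
  code-staircase v = trans (tabulate-cong reads-bit) (tabulate∘lookup v)
    where
    reads-bit : ∀ i → antidiagonal-bit (staircase v) (upper i) ≡ lookup v i
    reads-bit i = begin
      antidiagonal-bit (staircase v) (upper i) ≡⟨ cong (0 <ᵇ_) (entry-staircase v (upper i) (rev (upper i))) ⟩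
      (0 <ᵇ stair v x (toℕ (rev (upper i))))   ≡⟨ cong (λ y → 0 <ᵇ stair v x y) (toℕ-rev (upper i)) ⟩
      (0 <ᵇ stair v x (m ∸ x))                 ≡⟨ cong (0 <ᵇ_) (stair-≡ v x (m ∸ x) (m+[n∸m]≡n (toℕ≤m (upper i)))) ⟩
      (0 <ᵇ antidiagonal v x (m ∸ x))          ≡⟨ cong (0 <ᵇ_) (antidiagonal-upper v x (m ∸ x) x<a) ⟩
      (0 <ᵇ height (bitAt v x))                ≡⟨ positive-height (bitAt v x) ⟩
      bitAt v x                                ≡⟨ cong (bitAt v) (toℕ-inject≤ i _) ⟩
      bitAt v (toℕ i)                          ≡⟨ bitAt-toℕ v i ⟩
      lookup v i                               ∎
      where
      open ≡-Reasoning
      x : ℕ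
      x = toℕ (upper i)
      x<a : x < a
      x<a = subst (_< a) (sym (toℕ-inject≤ i _)) (toℕ<n i)

  staircase-injective : ∀ {v w} → staircase v ≡ staircase w → v ≡ w
  staircase-injective {v} {w} eq = trans (sym (code-staircase v)) (trans (cong code eq) (code-staircase w))

  module _ {π : Matrix a} (qcpp : IsQCPP a c π) (qtc : IsQuasiTransposeComplementary a c π) where

    private
      p : Index → Index → ℕ
      p = entry π

      sc : IsSelfComplementary a c π
      sc = qtc⇒sc {π} qcpp qtc

      entry-extreme : ∀ i j → p i j ≡ 0 ⊎ p i j ≡ c
      entry-extreme i j = *≡0⇒≡0⊎≡ (sc i j) (proj₁ (proj₂ qcpp) i j)

      -- A zero at (i, j) would propagate by monotonicity to (m−j, m−i), contradicting qtc.
      entry-above : ∀ i j → toℕ i + toℕ j < m → p i j ≡ c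
      entry-above i j lt with entry-extreme i j
      ... | inj₂ p≡c = p≡c
      ... | inj₁ p≡0 = ⊥-elim (0≢1+n (trans (sym (cong₂ _+_ p≡0 mirror≡0)) (qtc i j i≢rev-j)))
        where
        i≢rev-j : i ≢ rev j
        i≢rev-j eq = <-irrefl (≡rev⇒+≡m eq) lt
        i≤rev-j : i Fin.≤ rev j
        i≤rev-j = subst (toℕ i ≤_) (sym (toℕ-rev j)) (m+n≤o⇒m≤o∸n (toℕ i) (<⇒≤ lt))
        j≤rev-i : j Fin.≤ rev i
        j≤rev-i = subst (toℕ j ≤_) (sym (toℕ-rev i))
                        (m+n≤o⇒m≤o∸n (toℕ j) (<⇒≤ (subst (_< m) (+-comm (toℕ i) (toℕ j)) lt)))
        mirror≤ : p (rev j) (rev i) ≤ p i j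
        mirror≤ = ≤-trans (proj₁ (proj₁ qcpp) i (rev j) (rev i) i≤rev-j)
                          (proj₂ (proj₁ qcpp) i j (rev i) j≤rev-i)
        mirror≡0 : p (rev j) (rev i) ≡ 0
        mirror≡0 = n≤0⇒n≡0 (subst (p (rev j) (rev i) ≤_) p≡0 mirror≤)

      entry-below : ∀ i j → m < toℕ i + toℕ j → p i j ≡ 0
      entry-below i j gt = +-cancelʳ-≡ c (p i j) 0 (trans (cong (p i j +_) (sym mirror≡c)) (sc i j))
        where
        mirror< : toℕ (rev i) + toℕ (rev j) < m
        mirror< = subst (_< m) (sym (cong₂ _+_ (toℕ-rev i) (toℕ-rev j)))
                        (>⇒mirror< (toℕ≤m i) (toℕ≤m j) gt)
        mirror≡c : p (rev i) (rev j) ≡ c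
        mirror≡c = entry-above (rev i) (rev j) mirror<

      entry-antidiagonal : ∀ i j → toℕ i + toℕ j ≡ m → stair (code π) (toℕ i) (toℕ j) ≡ p i j
      entry-antidiagonal i j e = by-half (toℕ i <? a)
        where
        open ≡-Reasoning
        v : Code
        v = code π
        j≡rev-i : j ≡ rev i
        j≡rev-i = +≡m⇒≡rev (trans (+-comm (toℕ j) (toℕ i)) e)
        complement : p i j + p j (rev j) ≡ c
        complement = subst (λ l → p i j + p l (rev j) ≡ c) (sym j≡rev-i) (sc i j)
        by-half : Dec (toℕ i < a) → stair v (toℕ i) (toℕ j) ≡ p i j
        by-half (yes i<a) = begin
          stair v (toℕ i) (toℕ j)            ≡⟨ stair-≡ v (toℕ i) (toℕ j) e ⟩
          antidiagonal v (toℕ i) (toℕ j)     ≡⟨ antidiagonal-upper v (toℕ i) (toℕ j) i<a ⟩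
          height (bitAt v (toℕ i))           ≡⟨ cong height (bitAt-code π i i<a) ⟩
          height (0 <ᵇ p i (rev i))          ≡⟨ height-positive (entry-extreme i (rev i)) ⟩
          p i (rev i)                        ≡⟨ cong (p i) (sym j≡rev-i) ⟩
          p i j                              ∎
        by-half (no i≮a) = begin
          stair v (toℕ i) (toℕ j)            ≡⟨ stair-≡ v (toℕ i) (toℕ j) e ⟩
          antidiagonal v (toℕ i) (toℕ j)     ≡⟨ antidiagonal-lower v (toℕ i) (toℕ j) i≮a ⟩
          height (not (bitAt v (toℕ j)))     ≡⟨ cong (height ∘ not) (bitAt-code π j (+≡m-lower-half e i≮a)) ⟩
          height (not (0 <ᵇ p j (rev j)))    ≡⟨ height-not-positive complement (entry-extreme j (rev j)) ⟩
          p i j                              ∎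

      entry-staircase-code : ∀ i j → stair (code π) (toℕ i) (toℕ j) ≡ p i j
      entry-staircase-code i j = by-position (<-cmp (toℕ i + toℕ j) m)
        where
        by-position : Tri (toℕ i + toℕ j < m) (toℕ i + toℕ j ≡ m) (m < toℕ i + toℕ j) →
                      stair (code π) (toℕ i) (toℕ j) ≡ p i j
        by-position (tri< lt _ _) = trans (stair-< (code π) (toℕ i) (toℕ j) lt) (sym (entry-above i j lt))
        by-position (tri≈ _ e _)  = entry-antidiagonal i j e
        by-position (tri> _ _ gt) = trans (stair-> (code π) (toℕ i) (toℕ j) gt) (sym (entry-below i j gt))

    staircase-code : staircase (code π) ≡ π
    staircase-code = tabulate²-≗entry π entry-staircase-code

  staircases : List (Matrix a)
  staircases = map staircase (bitVectors a)

  ∈staircases⇔qcpp×qtc : ∀ π → π ∈ staircases ⇔ (IsQCPP a c π × IsQuasiTransposeComplementary a c π)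
  ∈staircases⇔qcpp×qtc π = mk⇔ to from
    where
    to : π ∈ staircases → IsQCPP a c π × IsQuasiTransposeComplementary a c π
    to π∈ with ∈-map⁻ staircase π∈
    ... | v , _ , refl = staircase-qcpp v , staircase-qtc v
    from : IsQCPP a c π × IsQuasiTransposeComplementary a c π → π ∈ staircases
    from (qcpp , qtc) = subst (_∈ staircases) (staircase-code {π} qcpp qtc)
                              (∈-map⁺ staircase (∈-bitVectors (code π)))

proposition3p4 : (a c : ℕ) → a ≥ 1 → c ≥ 1 →
    ((π : Matrix a) → IsQCPP a c π →
      (IsQuasiTransposeComplementary a c π ⇔ (IsQuasiSymmetric a π × IsSelfComplementary a c π)))
    × (∃[ L ] (Unique L × length L ≡ 2 ^ a ×
        ((π : Matrix a) → (π ∈ L ⇔ (IsQCPP a c π × IsQuasiTransposeComplementary a c π)))))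
proposition3p4 zero     _       ()
proposition3p4 (suc _)  zero    _  ()
proposition3p4 (suc a′) (suc k) _  _ =
    qtc⇔qs×sc
  , staircases
  , Unique.map⁺ staircase-injective (bitVectors-unique a)
  , trans (length-map staircase (bitVectors a)) (length-bitVectors a)
  , ∈staircases⇔qcpp×qtc
  where open QuarterComplementary a′ k
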